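{- Let $(G,w_e)$ be a connected edge-weighted graph with $w_e:E(G)\to[0,\infty)$, and let $\{F_1,\ldots,F_r\}$ be a c-partition of $E(G)$. Then $$\widehat{W}_e(G,w_e)=\sum_{i=1}^r\Big(W(G/F_i,w^i)+\widehat{W}_e(G/F_i,w_e^i)+W_{ve}(G/F_i,w^i,w_e^i)\Big).$$
   Context: All graphs are finite and simple; $d_G(u,v)$ is the shortest-path distance between vertices. For a vertex $v$ and edge $e=xy$, $d_G(v,e)=\min\{d_G(v,x),d_G(v,y)\}$; for edges $e=xy$, $f=ab$, $d_G(e,f)=\min\{d_G(x,a),d_G(x,b),d_G(y,a),d_G(y,b)\}$. For a graph $H$ with weights $w:V(H)\to[0,\infty)$ and $w_e:E(H)\to[0,\infty)$: $W(H,w)=\frac12\sum_{u\in V(H)}\sum_{v\in V(H)}w(u)w(v)d_H(u,v)$, $\widehat{W}_e(H,w_e)=\frac12\sum_{e\in E(H)}\sum_{f\in E(H)}w_e(e)w_e(f)d_H(e,f)$, $W_{ve}(H,w,w_e)=\sum_{v\in V(H)}\sum_{e\in E(H)}w(v)w_e(e)d_H(v,e)$. Two edges $e=xy$, $f=ab$ of $G$ are in relation $\Theta$ if $d_G(x,a)+d_G(y,b)\neq d_G(x,b)+d_G(y,a)$; $\Theta^*$ is its transitive closure, whose equivalence classes form the $\Theta^*$-partition of $E(G)$. A partition $\{F_1,\ldots,F_r\}$ of $E(G)$ is a c-partition if every $\Theta^*$-class is contained in some $F_i$. For $E'\subseteq E(G)$, the quotient graph $G/E'$ has as vertices the connected components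 of $G\setminus E'$ (delete the edges of $E'$), two components $X,Y$ adjacent iff some vertex of $X$ is adjacent in $G$ to some vertex of $Y$; such an edge $XY$ of $G/E'$ is also identified with the set of edges of $G$ with one end in $X$ and the other in $Y$. The weights on $G/F_i$ are: for each vertex $X$ of $G/F_i$, $w^i(X)=\sum_{e\in E(X)}w_e(e)$ (sum of weights of edges of the component $X$); for each edge $XY$ of $G/F_i$, $w_e^i(XY)$ is the sum of $w_e(e)$ over all edges $e$ of $G$ with one end in $X$ and the other in $Y$. -}

module Defs where

open import Level using (Level)
open import Data.Nat using (ℕ; zero; suc; _+_; _≤_; _⊓_)
open import Data.Fin using (Fin; _≟_) renaming (_<_ to _<ᶠ_)
open import Data.Product using (Σ; ∃; ∃₂; _×_; _,_; proj₁; proj₂)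
open import Data.Sum using (_⊎_)
open import Data.Bool using (Bool; true; false; if_then_else_; _∧_; _∨_; not)
open import Relation.Nullary using (¬_)
open import Relation.Nullary.Decidable using (⌊_⌋)
open import Relation.Binary.PropositionalEquality using (_≡_; _≢_)
open import Relation.Binary.Construct.Closure.Transitive using (TransClosure)
open import Function.Bundles using (_⇔_)
open import Algebra.Bundles using (CommutativeSemiring)

-- Vertices are Fin n, edges are Fin m; edge e joins the two distinct
-- vertices  ends e = (x , y)  stored with x < y, and distinct edges have
-- distinct end-pairs (no multi-edges).

record Graph : Set where
  field
    n : ℕ
    m : ℕ
    ends      : Fin m → Fin n × Fin n
    ordered   : ∀ e → proj₁ (ends e) <ᶠ proj₂ (ends e)
    injective : ∀ e f → ends e ≡ ends f → e ≡ f

open Graph public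

Vertex : Graph → Set
Vertex G = Fin (n G)

Edge : Graph → Set
Edge G = Fin (m G)

fst snd : (G : Graph) → Edge G → Vertex G
fst G e = proj₁ (ends G e)
snd G e = proj₂ (ends G e)

Adj : (G : Graph) → Vertex G → Vertex G → Set
Adj G u v = ∃ λ e → (ends G e ≡ (u , v)) ⊎ (ends G e ≡ (v , u))

data Walk (G : Graph) : Vertex G → Vertex G → ℕ → Set where
  nil  : ∀ {u} → Walk G u u zero
  cons : ∀ {u w v k} → Adj G u w → Walk G w v k → Walk G u v (suc k)

Connected : Graph → Set
Connected G = ∀ u v → ∃ λ k → Walk G u v k

IsDistance : (G : Graph) → (Vertex G → Vertex G → ℕ) → Set
IsDistance G d = ∀ u v → Walk G u v (d u v) × (∀ k → Walk G u v k → d u v ≤ k)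

distVE : (G : Graph) → (Vertex G → Vertex G → ℕ) → Vertex G → Edge G → ℕ
distVE G d v e = d v (fst G e) ⊓ d v (snd G e)

distEE : (G : Graph) → (Vertex G → Vertex G → ℕ) → Edge G → Edge G → ℕ
distEE G d e f =
  (d (fst G e) (fst G f) ⊓ d (fst G e) (snd G f)) ⊓
  (d (snd G e) (fst G f) ⊓ d (snd G e) (snd G f))

Θ : (G : Graph) → (Vertex G → Vertex G → ℕ) → Edge G → Edge G → Set
Θ G d e f =
  ¬ (d (fst G e) (fst G f) + d (snd G e) (snd G f)
     ≡ d (fst G e) (snd G f) + d (snd G e) (fst G f))

Θ* : (G : Graph) → (Vertex G → Vertex G → ℕ) → Edge G → Edge G → Set
Θ* G d = TransClosure (Θ G d)

-- A partition {F_1,…,F_r} of E(G) given by a labelling part : E(G) → Fin r,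
-- F_i = part⁻¹(i); every block nonempty; every Θ*-class inside one block.
IsCPartition : (G : Graph) → (Vertex G → Vertex G → ℕ) →
               (r : ℕ) → (Edge G → Fin r) → Set
IsCPartition G d r part =
  (∀ i → ∃ λ e → part e ≡ i) ×
  (∀ e f → Θ* G d e f → part e ≡ part f)

inPart : (G : Graph) {r : ℕ} → (Edge G → Fin r) → Fin r → Edge G → Bool
inPart G part i e = ⌊ part e ≟ i ⌋

data ConnAvoiding (G : Graph) (E' : Edge G → Bool) : Vertex G → Vertex G → Set where
  here : ∀ {u} → ConnAvoiding G E' u u
  step : ∀ {u w v} (e : Edge G) → E' e ≡ false →
         (ends G e ≡ (u , w)) ⊎ (ends G e ≡ (w , u)) →
         ConnAvoiding G E' w v → ConnAvoiding G E' u v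

-- H (with π : V(G) → V(H) sending a vertex to its component) is the
-- quotient graph G / E': the vertices of H are exactly the components of
-- G \ E', and distinct components X, Y are adjacent iff some vertex of X
-- is adjacent in G to some vertex of Y.
record IsQuotient (G : Graph) (E' : Edge G → Bool) (H : Graph)
                  (π : Vertex G → Vertex H) : Set where
  field
    surjective : ∀ X → ∃ λ u → π u ≡ X
    components : ∀ u v → (π u ≡ π v) ⇔ ConnAvoiding G E' u v
    adjacency  : ∀ X Y → Adj H X Y ⇔
                 (X ≢ Y × ∃₂ λ u v → Adj G u v × π u ≡ X × π v ≡ Y)

-- Weighted Wiener-type indices, with weights in a commutative semiring.
-- half is an element with half + half ≈ 1# (it plays the role of 1/2).

module Weighted {c ℓ : Level} (R : CommutativeSemiring c ℓ) where
  open CommutativeSemiring R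
  open import Algebra.Definitions.RawMonoid +-rawMonoid using (sum) renaming (_×_ to _·ℕ_)

  ∑ : ∀ {k} → (Fin k → Carrier) → Carrier
  ∑ f = sum f

  W : Carrier → (H : Graph) → (Vertex H → Vertex H → ℕ) →
      (Vertex H → Carrier) → Carrier
  W half H d w = half * ∑ λ u → ∑ λ v → d u v ·ℕ (w u * w v)

  We : Carrier → (H : Graph) → (Vertex H → Vertex H → ℕ) →
       (Edge H → Carrier) → Carrier
  We half H d we = half * ∑ λ e → ∑ λ f → distEE H d e f ·ℕ (we e * we f)

  Wve : (H : Graph) → (Vertex H → Vertex H → ℕ) →
        (Vertex H → Carrier) → (Edge H → Carrier) → Carrier
  Wve H d w we = ∑ λ v → ∑ λ e → distVE H d v e ·ℕ (w v * we e)

  wQ : (G : Graph) → (Edge G → Carrier) → (E' : Edge G → Bool) →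
       (H : Graph) → (Vertex G → Vertex H) → Vertex H → Carrier
  wQ G we E' H π X = ∑ λ e →
    if not (E' e) ∧ ⌊ π (fst G e) ≟ X ⌋ ∧ ⌊ π (snd G e) ≟ X ⌋
    then we e else 0#

  weQ : (G : Graph) → (Edge G → Carrier) → (H : Graph) →
        (Vertex G → Vertex H) → Edge H → Carrier
  weQ G we H π h = ∑ λ e →
    if (⌊ π (fst G e) ≟ fst H h ⌋ ∧ ⌊ π (snd G e) ≟ snd H h ⌋) ∨
       (⌊ π (fst G e) ≟ snd H h ⌋ ∧ ⌊ π (snd G e) ≟ fst H h ⌋)
    then we e else 0#

-- Klavžar's cut method.  Write dᵢ(u,v) for the distance between the images of u and v in G/Fᵢ.
-- A geodesic of G crosses exactly dᵢ(u,v) edges of Fᵢ: projecting it to G/Fᵢ gives one inequality;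
-- lifting a geodesic of G/Fᵢ gives a u–v walk of G with at most dᵢ(u,v) edges of Fᵢ, and no u–v walk
-- uses fewer Fᵢ-edges than a geodesic, by a potential argument that needs only that no edge of Fᵢ is
-- in relation Θ with an edge outside Fᵢ.  Hence d_G = Σᵢ dᵢ.  The ends of an edge e are identified in
-- every quotient except the one with e ∈ Fᵢ, so a pair of ends realising d_G(e,f) realises every
-- dᵢ(e,f), and d_G(e,f) = Σᵢ dᵢ(e,f).  Finally, in G/Fᵢ an edge e of G sits on a vertex (e ∉ Fᵢ) or on
-- an edge (e ∈ Fᵢ), at distance dᵢ(e,f) from where f sits, so W, Ŵ_e and W_ve of G/Fᵢ together make up
-- ½ Σ_{e,f} dᵢ(e,f) w(e) w(f), the pairs with e ∉ Fᵢ ∋ f being counted once in W_ve.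

module Submission where

open import Defs
open import Data.Nat using (ℕ)
open import Data.Fin using (Fin; _≟_; punchIn) renaming (_<_ to _<ᶠ_)
open import Data.Fin.Properties using (punchInᵢ≢i; <-irrefl; <-asym)
open import Data.Product using (Σ; _×_; _,_; proj₁; proj₂)
open import Data.Sum using (_⊎_; inj₁; inj₂)
open import Data.Bool using (Bool; true; false; if_then_else_; _∧_; _∨_; not)
open import Data.Bool.Properties using (∨-zeroʳ; ¬-not)
open import Data.Empty using (⊥-elim)
open import Function using (_∘_; id)
open import Function.Bundles using (Equivalence)
open import Relation.Nullary using (¬_; Dec; yes; no)
open import Relation.Nullary.Decidable using (⌊_⌋)
open import Relation.Binary.PropositionalEquality
  using (_≡_; _≢_; refl; sym; trans; cong; cong₂; subst; subst₂; ≢-sym; module ≡-Reasoning)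
open import Algebra.Bundles using (CommutativeSemiring)
import Relation.Binary.Reasoning.Setoid as SetoidReasoning
import Algebra.Properties.Semiring.Sum as SemiringSum
import Algebra.Properties.Semiring.Mult as SemiringMult

-- A separate module, so that ℕ's _+_ does not clash with the semiring's _+_ in the type of theorem3p3.
module GraphDistances where
  open import Data.Nat using (suc; _+_; _*_; _≤_; _⊓_; z≤n; s≤s)
  import Data.Nat.Properties as ℕ
  open import Data.Nat.Tactic.RingSolver using (solve-∀)
  open import Relation.Nullary.Decidable using (decidable-stable)
  open import Relation.Binary.Construct.Closure.Transitive using ([_])
  import Algebra.Properties.CommutativeMonoid.Sum as MonoidSum

  ⌊⌋-true : ∀ {a} {A : Set a} (a? : Dec A) → A → ⌊ a? ⌋ ≡ true
  ⌊⌋-true (yes _) _ = refl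
  ⌊⌋-true (no ¬a) a = ⊥-elim (¬a a)

  ⌊⌋-false : ∀ {a} {A : Set a} (a? : Dec A) → ¬ A → ⌊ a? ⌋ ≡ false
  ⌊⌋-false (yes a) ¬a = ⊥-elim (¬a a)
  ⌊⌋-false (no _) _ = refl

  ⌊⌋-true⁻¹ : ∀ {a} {A : Set a} (a? : Dec A) → ⌊ a? ⌋ ≡ true → A
  ⌊⌋-true⁻¹ (yes a) _ = a
  ⌊⌋-true⁻¹ (no _) ()

  ∧-true : ∀ {a b} → a ≡ true → b ≡ true → a ∧ b ≡ true
  ∧-true refl refl = refl

  ∧-true⁻¹ : ∀ a {b} → a ∧ b ≡ true → a ≡ true × b ≡ true
  ∧-true⁻¹ true  b≡ = refl , b≡
  ∧-true⁻¹ false ()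

  ∨-true⁻¹ : ∀ a {b} → a ∨ b ≡ true → a ≡ true ⊎ b ≡ true
  ∨-true⁻¹ true  _  = inj₁ refl
  ∨-true⁻¹ false b≡ = inj₂ b≡

  bit : Bool → ℕ
  bit b = if b then 1 else 0

  open MonoidSum ℕ.+-0-commutativeMonoid public
    using () renaming (sum to Σℕ; sum-cong-≗ to Σℕ-cong; ∑-distrib-+ to Σℕ-distrib-+;
                       sum-replicate-zero to Σℕ-zero; sum-remove to Σℕ-remove)

  indicator : ∀ {k} → Fin k → Fin k → ℕ
  indicator j i = bit ⌊ j ≟ i ⌋

  Σℕ-indicator : ∀ {k} (j : Fin k) → Σℕ (indicator j) ≡ 1
  Σℕ-indicator {suc k} j = begin
    Σℕ (indicator j)                            ≡⟨ Σℕ-remove {i = j} (indicator j) ⟩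
    indicator j j + Σℕ (indicator j ∘ punchIn j) ≡⟨ cong₂ _+_ on-j (Σℕ-cong off-j) ⟩
    1 + Σℕ {k} (λ _ → 0)                         ≡⟨ cong suc (Σℕ-zero k) ⟩
    1                                            ∎
    where
    open ≡-Reasoning
    on-j : indicator j j ≡ 1
    on-j rewrite ⌊⌋-true (j ≟ j) refl = refl
    off-j : ∀ l → indicator j (punchIn j l) ≡ 0
    off-j l rewrite ⌊⌋-false (j ≟ punchIn j l) (punchInᵢ≢i j l ∘ sym) = refl

  Σℕ-≤-at : ∀ {k} (f g : Fin k → ℕ) i → (∀ j → j ≢ i → f j ≡ g j) →
            Σℕ f ≤ Σℕ g → f i ≤ g i
  Σℕ-≤-at {suc k} f g i agree Σf≤Σg = ℕ.+-cancelʳ-≤ (Σℕ (f ∘ punchIn i)) (f i) (g i) (begin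
    f i + Σℕ (f ∘ punchIn i) ≡⟨ Σℕ-remove f ⟨
    Σℕ f                     ≤⟨ Σf≤Σg ⟩
    Σℕ g                     ≡⟨ Σℕ-remove g ⟩
    g i + Σℕ (g ∘ punchIn i) ≡⟨ cong (g i +_) (Σℕ-cong (λ l → agree _ (punchInᵢ≢i i l))) ⟨
    g i + Σℕ (f ∘ punchIn i) ∎)
    where open ℕ.≤-Reasoning

  Σℕ-minimiser : ∀ {r} {S : Set} (g : Fin r → S → ℕ) (mix : Fin r → S → S → S) →
                 (∀ i s s₀ → g i (mix i s s₀) ≡ g i s) →
                 (∀ i j s s₀ → j ≢ i → g j (mix i s s₀) ≡ g j s₀) →
                 ∀ s₀ → (∀ s → Σℕ (λ j → g j s₀) ≤ Σℕ (λ j → g j s)) →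
                 ∀ i s → g i s₀ ≤ g i s
  Σℕ-minimiser g mix mix-here mix-elsewhere s₀ minimal i s =
    subst (g i s₀ ≤_) (mix-here i s s₀)
      (Σℕ-≤-at (λ j → g j s₀) (λ j → g j (mix i s s₀)) i
        (λ j j≢i → sym (mix-elsewhere i j s s₀ j≢i)) (minimal (mix i s s₀)))

  min₄ : (Bool → Bool → ℕ) → ℕ
  min₄ g = (g false false ⊓ g false true) ⊓ (g true false ⊓ g true true)

  min₄-≤ : ∀ g b c → min₄ g ≤ g b c
  min₄-≤ g false false = ℕ.≤-trans (ℕ.m⊓n≤m _ _) (ℕ.m⊓n≤m _ _)
  min₄-≤ g false true  = ℕ.≤-trans (ℕ.m⊓n≤m _ _) (ℕ.m⊓n≤n _ _)
  min₄-≤ g true  false = ℕ.≤-trans (ℕ.m⊓n≤n _ _) (ℕ.m⊓n≤m _ _)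
  min₄-≤ g true  true  = ℕ.≤-trans (ℕ.m⊓n≤n _ _) (ℕ.m⊓n≤n _ _)

  min₄-attained : ∀ g → Σ Bool λ b → Σ Bool λ c → min₄ g ≡ g b c
  min₄-attained g with ℕ.⊓-sel (g false false ⊓ g false true) (g true false ⊓ g true true)
  ... | inj₁ p with ℕ.⊓-sel (g false false) (g false true)
  ...   | inj₁ q = false , false , trans p q
  ...   | inj₂ q = false , true  , trans p q
  min₄-attained g | inj₂ p with ℕ.⊓-sel (g true false) (g true true)
  ...   | inj₁ q = true , false , trans p q
  ...   | inj₂ q = true , true  , trans p q

  min₄-at-minimum : ∀ g b c → (∀ b′ c′ → g b c ≤ g b′ c′) → min₄ g ≡ g b c
  min₄-at-minimum g b c minimal = ℕ.≤-antisym (min₄-≤ g b c)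
    (ℕ.⊓-glb (ℕ.⊓-glb (minimal _ _) (minimal _ _)) (ℕ.⊓-glb (minimal _ _) (minimal _ _)))

  min₄-cong : ∀ {g h} → (∀ b c → g b c ≡ h b c) → min₄ g ≡ min₄ h
  min₄-cong g≡h = cong₂ _⊓_ (cong₂ _⊓_ (g≡h _ _) (g≡h _ _)) (cong₂ _⊓_ (g≡h _ _) (g≡h _ _))

  min₄-notˡ : ∀ g → min₄ (λ b c → g (not b) c) ≡ min₄ g
  min₄-notˡ g = ℕ.⊓-comm _ _

  min₄-notʳ : ∀ g → min₄ (λ b c → g b (not c)) ≡ min₄ g
  min₄-notʳ g = cong₂ _⊓_ (ℕ.⊓-comm _ _) (ℕ.⊓-comm _ _)

  min₄-transpose : ∀ g → min₄ (λ b c → g c b) ≡ min₄ g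
  min₄-transpose g = begin
    (a ⊓ c) ⊓ (b ⊓ e) ≡⟨ ℕ.⊓-assoc a c (b ⊓ e) ⟩
    a ⊓ (c ⊓ (b ⊓ e)) ≡⟨ cong (a ⊓_) (sym (ℕ.⊓-assoc c b e)) ⟩
    a ⊓ ((c ⊓ b) ⊓ e) ≡⟨ cong (λ t → a ⊓ (t ⊓ e)) (ℕ.⊓-comm c b) ⟩
    a ⊓ ((b ⊓ c) ⊓ e) ≡⟨ cong (a ⊓_) (ℕ.⊓-assoc b c e) ⟩
    a ⊓ (b ⊓ (c ⊓ e)) ≡⟨ sym (ℕ.⊓-assoc a b (c ⊓ e)) ⟩
    (a ⊓ b) ⊓ (c ⊓ e) ∎
    where
    open ≡-Reasoning
    a = g false false
    b = g false true
    c = g true false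
    e = g true true

  min₄-const : ∀ n → min₄ (λ _ _ → n) ≡ n
  min₄-const n = trans (cong₂ _⊓_ (ℕ.⊓-idem n) (ℕ.⊓-idem n)) (ℕ.⊓-idem n)

  min₄-constˡ : ∀ (g : Bool → ℕ) → min₄ (λ _ c → g c) ≡ g false ⊓ g true
  min₄-constˡ g = ℕ.⊓-idem (g false ⊓ g true)

  module _ {r : ℕ} (g : Fin r → Bool → Bool → ℕ) (i₁ i₂ : Fin r)
           (free₁ : ∀ j → j ≢ i₁ → ∀ b b′ c → g j b c ≡ g j b′ c)
           (free₂ : ∀ j → j ≢ i₂ → ∀ b c c′ → g j b c ≡ g j b c′) where

    private
      choose : Fin r → Fin r → Bool → Bool → Bool
      choose k i b b₀ = if ⌊ k ≟ i ⌋ then b else b₀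

      mix : Fin r → Bool × Bool → Bool × Bool → Bool × Bool
      mix i (b , c) (b₀ , c₀) = choose i₁ i b b₀ , choose i₂ i c c₀

      g² : Fin r → Bool × Bool → ℕ
      g² j (b , c) = g j b c

      mix-here : ∀ i s s₀ → g² i (mix i s s₀) ≡ g² i s
      mix-here i (b , c) (b₀ , c₀) with i₁ ≟ i | i₂ ≟ i
      ... | yes _  | yes _  = refl
      ... | yes _  | no i₂≢i = free₂ i (i₂≢i ∘ sym) b c₀ c
      ... | no i₁≢i | yes _  = free₁ i (i₁≢i ∘ sym) b₀ b c
      ... | no i₁≢i | no i₂≢i =
        trans (free₁ i (i₁≢i ∘ sym) b₀ b c₀) (free₂ i (i₂≢i ∘ sym) b c₀ c)

      mix-elsewhere : ∀ i j s s₀ → j ≢ i → g² j (mix i s s₀) ≡ g² j s₀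
      mix-elsewhere i j (b , c) (b₀ , c₀) j≢i with i₁ ≟ i | i₂ ≟ i
      ... | yes refl | yes refl = trans (free₁ j j≢i b b₀ c) (free₂ j j≢i b₀ c c₀)
      ... | yes refl | no _     = free₁ j j≢i b b₀ c₀
      ... | no _     | yes refl = free₂ j j≢i b₀ c c₀
      ... | no _     | no _     = refl

    min₄-Σℕ : min₄ (λ b c → Σℕ (λ j → g j b c)) ≡ Σℕ (λ j → min₄ (g j))
    min₄-Σℕ with min₄-attained (λ b c → Σℕ (λ j → g j b c))
    ... | b₀ , c₀ , attained = begin
      min₄ (λ b c → Σℕ (λ j → g j b c)) ≡⟨ attained ⟩
      Σℕ (λ j → g j b₀ c₀)              ≡⟨ Σℕ-cong (λ j → sym (min₄-at-minimum (g j) b₀ c₀ (local j))) ⟩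
      Σℕ (λ j → min₄ (g j))             ∎
      where
      open ≡-Reasoning
      global : ∀ s → Σℕ (λ j → g² j (b₀ , c₀)) ≤ Σℕ (λ j → g² j s)
      global (b , c) = subst (_≤ Σℕ (λ j → g j b c)) attained (min₄-≤ (λ b c → Σℕ (λ j → g j b c)) b c)
      local : ∀ j b c → g j b₀ c₀ ≤ g j b c
      local j b c = Σℕ-minimiser g² mix mix-here mix-elsewhere (b₀ , c₀) global j (b , c)

  SameEnds : {A : Set} → A × A → A × A → Set
  SameEnds (x₁ , x₂) (y₁ , y₂) = (x₁ ≡ y₁ × x₂ ≡ y₂) ⊎ (x₁ ≡ y₂ × x₂ ≡ y₁)

  SameEnds-sym : ∀ {A : Set} {p q : A × A} → SameEnds p q → SameEnds q p
  SameEnds-sym (inj₁ (x₁≡ , x₂≡)) = inj₁ (sym x₁≡ , sym x₂≡)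
  SameEnds-sym (inj₂ (x₁≡ , x₂≡)) = inj₂ (sym x₂≡ , sym x₁≡)

  SameEnds-flip : ∀ {A : Set} (x y : Bool → A) → SameEnds (x false , x true) (y false , y true) →
                  (∀ b → x b ≡ y b) ⊎ (∀ b → x b ≡ y (not b))
  SameEnds-flip x y (inj₁ (p , q)) = inj₁ λ { false → p ; true → q }
  SameEnds-flip x y (inj₂ (p , q)) = inj₂ λ { false → p ; true → q }

  min₄-SameEnds : ∀ {V : Set} (g : V → V → ℕ) (x y x′ y′ : Bool → V) →
                  SameEnds (x false , x true) (x′ false , x′ true) →
                  SameEnds (y false , y true) (y′ false , y′ true) →
                  min₄ (λ b c → g (x b) (y c)) ≡ min₄ (λ b c → g (x′ b) (y′ c))
  min₄-SameEnds g x y x′ y′ sx sy with SameEnds-flip x x′ sx | SameEnds-flip y y′ sy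
  ... | inj₁ x≡ | inj₁ y≡ = min₄-cong (λ b c → cong₂ g (x≡ b) (y≡ c))
  ... | inj₁ x≡ | inj₂ y≡ =
    trans (min₄-cong (λ b c → cong₂ g (x≡ b) (y≡ c))) (min₄-notʳ (λ b c → g (x′ b) (y′ c)))
  ... | inj₂ x≡ | inj₁ y≡ =
    trans (min₄-cong (λ b c → cong₂ g (x≡ b) (y≡ c))) (min₄-notˡ (λ b c → g (x′ b) (y′ c)))
  ... | inj₂ x≡ | inj₂ y≡ = trans (min₄-cong (λ b c → cong₂ g (x≡ b) (y≡ c)))
    (trans (min₄-notˡ (λ b c → g (x′ b) (y′ (not c)))) (min₄-notʳ (λ b c → g (x′ b) (y′ c))))

  -- distEE G d e f is definitionally min₄ (λ b c → d (end G e b) (end G f c)).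
  end : (G : Graph) → Edge G → Bool → Vertex G
  end G e b = if b then snd G e else fst G e

  distEE-sym : ∀ G {d : Vertex G → Vertex G → ℕ} → (∀ x y → d x y ≡ d y x) →
               ∀ e f → distEE G d e f ≡ distEE G d f e
  distEE-sym G {d} d-sym e f = trans (min₄-cong (λ b c → d-sym (end G e b) (end G f c)))
                                     (min₄-transpose (λ b c → d (end G f b) (end G e c)))

  SameEnds-loop : ∀ G {x} e → ¬ SameEnds (x , x) (ends G e)
  SameEnds-loop G e (inj₁ (p , q)) = <-irrefl (trans (sym p) q) (ordered G e)
  SameEnds-loop G e (inj₂ (p , q)) = <-irrefl (trans (sym q) p) (ordered G e)

  SameEnds-injective : ∀ G {p} e f → SameEnds p (ends G e) → SameEnds p (ends G f) → e ≡ f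
  SameEnds-injective G e f (inj₁ (p , q)) (inj₁ (p′ , q′)) =
    injective G e f (cong₂ _,_ (trans (sym p) p′) (trans (sym q) q′))
  SameEnds-injective G e f (inj₂ (p , q)) (inj₂ (p′ , q′)) =
    injective G e f (cong₂ _,_ (trans (sym q) q′) (trans (sym p) p′))
  SameEnds-injective G e f (inj₁ (p , q)) (inj₂ (p′ , q′)) =
    ⊥-elim (<-asym (ordered G e) (subst₂ _<ᶠ_ (trans (sym q′) q) (trans (sym p′) p) (ordered G f)))
  SameEnds-injective G e f (inj₂ (p , q)) (inj₁ (p′ , q′)) =
    ⊥-elim (<-asym (ordered G e) (subst₂ _<ᶠ_ (trans (sym p′) p) (trans (sym q′) q) (ordered G f)))

  adj-ends : ∀ {G u w e} → (ends G e ≡ (u , w)) ⊎ (ends G e ≡ (w , u)) → SameEnds (ends G e) (u , w)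
  adj-ends (inj₁ q) = inj₁ (cong proj₁ q , cong proj₂ q)
  adj-ends (inj₂ q) = inj₂ (cong proj₁ q , cong proj₂ q)

  module _ {G : Graph} where

    adj-sym : ∀ {u v} → Adj G u v → Adj G v u
    adj-sym (e , inj₁ p) = e , inj₂ p
    adj-sym (e , inj₂ p) = e , inj₁ p

    _++ʷ_ : ∀ {u w v k l} → Walk G u w k → Walk G w v l → Walk G u v (k + l)
    nil      ++ʷ V = V
    cons a U ++ʷ V = cons a (U ++ʷ V)

    reverseʷ : ∀ {u v k} → Walk G u v k → Walk G v u k
    reverseʷ nil = nil
    reverseʷ {k = suc k} (cons a U) = subst (Walk G _ _) (ℕ.+-comm k 1) (reverseʷ U ++ʷ cons (adj-sym a) nil)

  module Distance {G : Graph} {d : Vertex G → Vertex G → ℕ} (isD : IsDistance G d) where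

    geodesic : ∀ u v → Walk G u v (d u v)
    geodesic u v = proj₁ (isD u v)

    d≤length : ∀ {u v k} → Walk G u v k → d u v ≤ k
    d≤length U = proj₂ (isD _ _) _ U

    d-sym : ∀ u v → d u v ≡ d v u
    d-sym u v = ℕ.≤-antisym (d≤length (reverseʷ (geodesic v u))) (d≤length (reverseʷ (geodesic u v)))

    d-triangle : ∀ u w v → d u v ≤ d u w + d w v
    d-triangle u w v = d≤length (geodesic u w ++ʷ geodesic w v)

    d-adj : ∀ {u w} v → Adj G u w → d u v ≤ suc (d w v)
    d-adj v a = d≤length (cons a (geodesic _ v))

    d-adj≤1 : ∀ {u w} → Adj G u w → d u w ≤ 1
    d-adj≤1 a = d≤length (cons a nil)

    d-refl : ∀ u → d u u ≡ 0
    d-refl u = ℕ.n≤0⇒n≡0 (d≤length nil)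

    d≡0⇒≡ : ∀ {u v} → d u v ≡ 0 → u ≡ v
    d≡0⇒≡ {u} {v} eq = walk₀ (subst (Walk G u v) eq (geodesic u v))
      where
      walk₀ : ∀ {v} → Walk G u v 0 → u ≡ v
      walk₀ nil = refl

    step-away : ∀ {u p w v k} → Adj G p w → Walk G w v k → d u p + suc k ≡ d u v → d u w ≡ suc (d u p)
    step-away {u} {p} {w} {v} {k} a U tight = ℕ.≤-antisym upper lower
      where
      open ℕ.≤-Reasoning
      upper : d u w ≤ suc (d u p)
      upper = begin
        d u w         ≤⟨ d-triangle u p w ⟩
        d u p + d p w ≤⟨ ℕ.+-monoʳ-≤ (d u p) (d-adj≤1 a) ⟩
        d u p + 1     ≡⟨ ℕ.+-comm (d u p) 1 ⟩
        suc (d u p)   ∎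
      lower : suc (d u p) ≤ d u w
      lower = ℕ.+-cancelʳ-≤ k _ _ (begin
        suc (d u p) + k ≡⟨ ℕ.+-suc (d u p) k ⟨
        d u p + suc k   ≡⟨ tight ⟩
        d u v           ≤⟨ d-triangle u w v ⟩
        d u w + d w v   ≤⟨ ℕ.+-monoʳ-≤ (d u w) (d≤length U) ⟩
        d u w + k       ∎)

    step-away-tight : ∀ {u p w v k} → Adj G p w → Walk G w v k → d u p + suc k ≡ d u v → d u w + k ≡ d u v
    step-away-tight {u} {p} {k = k} a U tight =
      trans (cong (_+ k) (step-away a U tight)) (trans (sym (ℕ.+-suc (d u p) k)) tight)

    step-towards : ∀ {p w v k} → Adj G p w → Walk G w v k → d p v ≡ suc k → d w v ≡ k
    step-towards a U tight =
      ℕ.≤-antisym (d≤length U) (ℕ.≤-pred (subst (_≤ suc (d _ _)) tight (d-adj _ a)))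

  quotient-merges : ∀ {G F H π} → IsQuotient G F H π →
                    ∀ {u w} (a : Adj G u w) → F (proj₁ a) ≡ false → π u ≡ π w
  quotient-merges isQ {u} {w} (e , o) Fe = Equivalence.from (IsQuotient.components isQ u w) (step e Fe o here)

  IsΘClosed : (G : Graph) → (Vertex G → Vertex G → ℕ) → (Edge G → Bool) → Set
  IsΘClosed G d F = ∀ e f → F e ≢ F f → ¬ Θ G d e f

  inPart-isΘClosed : ∀ {G d r part} → IsCPartition G d r part → ∀ i → IsΘClosed G d (inPart G part i)
  inPart-isΘClosed (_ , closed) i e f F≢ θ = F≢ (cong (λ j → ⌊ j ≟ i ⌋) (closed e f [ θ ]))

  module ΘClosedCut {G : Graph} {d : Vertex G → Vertex G → ℕ} (isD : IsDistance G d)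
                    (F : Edge G → Bool) (closed : IsΘClosed G d F) where
    open Distance isD

    edge : ∀ {u v} → Adj G u v → Edge G
    edge = proj₁

    count : ∀ {u v k} → Walk G u v k → ℕ
    count nil        = 0
    count (cons a U) = bit (F (edge a)) + count U

    count-++ : ∀ {u w v k l} (U : Walk G u w k) (V : Walk G w v l) → count (U ++ʷ V) ≡ count U + count V
    count-++ nil        V = refl
    count-++ (cons a U) V =
      trans (cong (bit (F (edge a)) +_) (count-++ U V)) (sym (ℕ.+-assoc (bit (F (edge a))) _ _))

    F-differ : ∀ {e f} → F e ≡ true → F f ≡ false → F e ≢ F f
    F-differ Fe Ff Fe≡Ff with trans (sym Fe) (trans Fe≡Ff Ff)
    ... | ()

    -- Up to the symmetry of d, Θ holds between the edges uw and ab exactly when Balanced u w a b fails.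
    Balanced : Vertex G → Vertex G → Vertex G → Vertex G → Set
    Balanced u w a b = d a w + d b u ≡ d b w + d a u

    balanced-flip : ∀ {u w a b} → Balanced u w a b → Balanced w u a b
    balanced-flip {u} {w} {a} {b} bal =
      trans (ℕ.+-comm (d a u) (d b w)) (trans (sym bal) (ℕ.+-comm (d a w) (d b u)))

    ends-balanced : ∀ e f → F e ≢ F f → Balanced (fst G e) (snd G e) (fst G f) (snd G f)
    ends-balanced e f F≢ = begin
      d f₁ e₂ + d f₂ e₁ ≡⟨ cong₂ _+_ (d-sym f₁ e₂) (d-sym f₂ e₁) ⟩
      d e₂ f₁ + d e₁ f₂ ≡⟨ ℕ.+-comm (d e₂ f₁) (d e₁ f₂) ⟩
      d e₁ f₂ + d e₂ f₁ ≡⟨ decidable-stable (_ ℕ.≟ _) (closed e f F≢) ⟨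
      d e₁ f₁ + d e₂ f₂ ≡⟨ ℕ.+-comm (d e₁ f₁) (d e₂ f₂) ⟩
      d e₂ f₂ + d e₁ f₁ ≡⟨ cong₂ _+_ (d-sym e₂ f₂) (d-sym e₁ f₁) ⟩
      d f₂ e₂ + d f₁ e₁ ∎
      where
      open ≡-Reasoning
      e₁ = fst G e
      e₂ = snd G e
      f₁ = fst G f
      f₂ = snd G f

    adj-balanced : ∀ {u w a b} (α : Adj G u w) (β : Adj G a b) →
                   F (edge α) ≢ F (edge β) → Balanced u w a b
    adj-balanced (e , oe) (f , of) F≢ with adj-ends {G} {e = e} oe | adj-ends {G} {e = f} of
    ... | inj₁ (refl , refl) | inj₁ (refl , refl) = ends-balanced e f F≢
    ... | inj₁ (refl , refl) | inj₂ (refl , refl) = sym (ends-balanced e f F≢)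
    ... | inj₂ (refl , refl) | inj₁ (refl , refl) = balanced-flip (ends-balanced e f F≢)
    ... | inj₂ (refl , refl) | inj₂ (refl , refl) = balanced-flip (sym (ends-balanced e f F≢))

    -- Σhead P z − Σtail P z is the total change of the distance to z across the F-edges of P.  Moving z
    -- along an edge β changes it by at most 2·[β ∈ F], because an edge of P and β are balanced whenever
    -- exactly one of them lies in F; on a geodesic P it is count P at the start and −count P at the end.
    Σhead Σtail : ∀ {p v k} → Walk G p v k → Vertex G → ℕ
    Σhead nil                  z = 0
    Σhead (cons {w = w} α P) z = (if F (edge α) then d z w else 0) + Σhead P z
    Σtail nil                  z = 0
    Σtail (cons {u = u} α P) z = (if F (edge α) then d z u else 0) + Σtail P z

    potential-step-∉ : ∀ {a b} (β : Adj G a b) → F (edge β) ≡ false →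
                       ∀ {p v k} (P : Walk G p v k) → Σhead P a + Σtail P b ≡ Σhead P b + Σtail P a
    potential-step-∉ β Fβ nil = refl
    potential-step-∉ {a} {b} β Fβ (cons {u = p} {w = w} α P) with F (edge α) in Fα
    ... | true = begin
      (d a w + Σhead P a) + (d b p + Σtail P b) ≡⟨ interchange (d a w) (d b p) (Σhead P a) (Σtail P b) ⟩
      (d a w + d b p) + (Σhead P a + Σtail P b)
        ≡⟨ cong₂ _+_ (adj-balanced α β (F-differ Fα Fβ)) (potential-step-∉ β Fβ P) ⟩
      (d b w + d a p) + (Σhead P b + Σtail P a) ≡⟨ interchange (d b w) (d a p) (Σhead P b) (Σtail P a) ⟨
      (d b w + Σhead P b) + (d a p + Σtail P a) ∎
      where
      open ≡-Reasoning
      interchange : ∀ x y z t → (x + z) + (y + t) ≡ (x + y) + (z + t)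
      interchange = solve-∀
    ... | false = potential-step-∉ β Fβ P

    potential-step-∈ : ∀ {a b} (β : Adj G a b) → F (edge β) ≡ true →
                       ∀ {p v k} (P : Walk G p v k) →
                       Σhead P a + Σtail P b + (d b v + d a p) ≡ Σhead P b + Σtail P a + (d a v + d b p)
    potential-step-∈ {a} {b} β Fβ {p} nil = ℕ.+-comm (d b p) (d a p)
    potential-step-∈ {a} {b} β Fβ (cons {u = p} {w = w} {v = v} α P) with F (edge α) in Fα
    ... | true = begin
      (d a w + Σhead P a) + (d b p + Σtail P b) + (d b v + d a p)
        ≡⟨ shuffle₁ (Σhead P a) (Σtail P b) (d a w) (d b v) (d b p) (d a p) ⟩
      (Σhead P a + Σtail P b + (d b v + d a w)) + (d b p + d a p)
        ≡⟨ cong (_+ (d b p + d a p)) (potential-step-∈ β Fβ P) ⟩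
      (Σhead P b + Σtail P a + (d a v + d b w)) + (d b p + d a p)
        ≡⟨ shuffle₂ (Σhead P b) (Σtail P a) (d a v) (d b w) (d b p) (d a p) ⟩
      (d b w + Σhead P b) + (d a p + Σtail P a) + (d a v + d b p) ∎
      where
      open ≡-Reasoning
      shuffle₁ : ∀ x y z s t u → (z + x) + (t + y) + (s + u) ≡ (x + y + (s + z)) + (t + u)
      shuffle₁ = solve-∀
      shuffle₂ : ∀ x y z s t u → (x + y + (z + s)) + (t + u) ≡ (s + x) + (u + y) + (z + t)
      shuffle₂ = solve-∀
    ... | false = ℕ.+-cancelʳ-≡ (d b w) _ _ (begin
      Σhead P a + Σtail P b + (d b v + d a p) + d b w
        ≡⟨ shuffle₁ (Σhead P a + Σtail P b) (d b v) (d b w) (d a p) ⟩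
      (Σhead P a + Σtail P b + d b v) + (d b w + d a p)
        ≡⟨ cong ((Σhead P a + Σtail P b + d b v) +_) (adj-balanced α β (≢-sym (F-differ Fβ Fα))) ⟨
      (Σhead P a + Σtail P b + d b v) + (d a w + d b p)
        ≡⟨ shuffle₂ (Σhead P a + Σtail P b) (d b v) (d a w) (d b p) ⟩
      (Σhead P a + Σtail P b + (d b v + d a w)) + d b p
        ≡⟨ cong (_+ d b p) (potential-step-∈ β Fβ P) ⟩
      (Σhead P b + Σtail P a + (d a v + d b w)) + d b p
        ≡⟨ shuffle₃ (Σhead P b + Σtail P a) (d a v) (d b w) (d b p) ⟩
      Σhead P b + Σtail P a + (d a v + d b p) + d b w ∎)
      where
      open ≡-Reasoning
      shuffle₁ : ∀ x y z t → x + (y + t) + z ≡ (x + y) + (z + t)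
      shuffle₁ = solve-∀
      shuffle₂ : ∀ x y z t → (x + y) + (z + t) ≡ (x + (y + z)) + t
      shuffle₂ = solve-∀
      shuffle₃ : ∀ x y z t → (x + (y + z)) + t ≡ x + (y + t) + z
      shuffle₃ = solve-∀

    potential-step : ∀ {a b} (β : Adj G a b) {p v k} (P : Walk G p v k) →
                     Σhead P a + Σtail P b ≤ Σhead P b + Σtail P a + 2 * bit (F (edge β))
    potential-step {a} {b} β {p} {v} P with F (edge β) in Fβ
    ... | false = ℕ.≤-reflexive (trans (potential-step-∉ β Fβ P) (sym (ℕ.+-identityʳ _)))
    ... | true  = ℕ.+-cancelʳ-≤ (d b v + d a p) _ _ (begin
      Σhead P a + Σtail P b + (d b v + d a p)       ≡⟨ potential-step-∈ β Fβ P ⟩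
      Σhead P b + Σtail P a + (d a v + d b p)
        ≤⟨ ℕ.+-monoʳ-≤ (Σhead P b + Σtail P a) (ℕ.+-mono-≤ (d-adj v β) (d-adj p (adj-sym {G} β))) ⟩
      Σhead P b + Σtail P a + (suc (d b v) + suc (d a p))
        ≡⟨ shuffle (Σhead P b + Σtail P a) (d b v) (d a p) ⟩
      Σhead P b + Σtail P a + 2 + (d b v + d a p)   ∎)
      where
      open ℕ.≤-Reasoning
      shuffle : ∀ x y z → x + (suc y + suc z) ≡ x + 2 + (y + z)
      shuffle = solve-∀

    potential-walk : ∀ {p v k} (P : Walk G p v k) {a b l} (U : Walk G a b l) →
                     Σhead P a + Σtail P b ≤ Σhead P b + Σtail P a + 2 * count U
    potential-walk P nil = ℕ.≤-reflexive (sym (ℕ.+-identityʳ _))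
    potential-walk P {a} {b} (cons {w = w} β U) = ℕ.+-cancelʳ-≤ (Σhead P w + Σtail P w) _ _ (begin
      Σhead P a + Σtail P b + (Σhead P w + Σtail P w)
        ≡⟨ shuffle₁ (Σhead P a) (Σhead P w) (Σtail P w) (Σtail P b) ⟩
      (Σhead P a + Σtail P w) + (Σhead P w + Σtail P b)
        ≤⟨ ℕ.+-mono-≤ (potential-step β P) (potential-walk P U) ⟩
      (Σhead P w + Σtail P a + 2 * bit (F (edge β))) + (Σhead P b + Σtail P w + 2 * count U)
        ≡⟨ shuffle₂ (Σhead P w) (Σtail P a) (Σhead P b) (Σtail P w) (bit (F (edge β))) (count U) ⟩
      Σhead P b + Σtail P a + 2 * (bit (F (edge β)) + count U) + (Σhead P w + Σtail P w) ∎)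
      where
      open ℕ.≤-Reasoning
      shuffle₁ : ∀ x y z t → (x + t) + (y + z) ≡ (x + z) + (y + t)
      shuffle₁ = solve-∀
      shuffle₂ : ∀ x y z t m n → (x + y + 2 * m) + (z + t + 2 * n) ≡ (z + y + 2 * (m + n)) + (x + t)
      shuffle₂ = solve-∀

    Σhead-away : ∀ u {p v k} (P : Walk G p v k) → d u p + k ≡ d u v → Σhead P u ≡ Σtail P u + count P
    Σhead-away u nil tight = refl
    Σhead-away u {p} {v} {suc k} (cons {w = w} α P) tight with F (edge α)
    ... | true = begin
      d u w + Σhead P u
        ≡⟨ cong₂ _+_ (step-away α P tight) (Σhead-away u P (step-away-tight α P tight)) ⟩
      suc (d u p) + (Σtail P u + count P) ≡⟨ shuffle (d u p) (Σtail P u) (count P) ⟩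
      (d u p + Σtail P u) + (1 + count P) ∎
      where
      open ≡-Reasoning
      shuffle : ∀ x y z → suc x + (y + z) ≡ (x + y) + (1 + z)
      shuffle = solve-∀
    ... | false = Σhead-away u P (step-away-tight α P tight)

    Σtail-towards : ∀ {p v k} (P : Walk G p v k) → d p v ≡ k → Σtail P v ≡ Σhead P v + count P
    Σtail-towards nil tight = refl
    Σtail-towards {p} {v} {suc k} (cons {w = w} α P) tight with F (edge α)
    ... | true = begin
      d v p + Σtail P v                   ≡⟨ cong₂ _+_ away (Σtail-towards P towards) ⟩
      suc (d v w) + (Σhead P v + count P) ≡⟨ shuffle (d v w) (Σhead P v) (count P) ⟩
      (d v w + Σhead P v) + (1 + count P) ∎
      where
      open ≡-Reasoning
      towards : d w v ≡ k
      towards = step-towards α P tight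
      away : d v p ≡ suc (d v w)
      away = trans (d-sym v p) (trans tight (cong suc (trans (sym towards) (d-sym w v))))
      shuffle : ∀ x y z → suc x + (y + z) ≡ (x + y) + (1 + z)
      shuffle = solve-∀
    ... | false = Σtail-towards P (step-towards α P tight)

    geodesic-count-minimal : ∀ {u v k} (P : Walk G u v k) → d u v ≡ k →
                             ∀ {l} (U : Walk G u v l) → count P ≤ count U
    geodesic-count-minimal {u} {v} {k} P tight U =
      ℕ.*-cancelˡ-≤ 2 (ℕ.+-cancelˡ-≤ (Σhead P v + Σtail P u) _ _ (begin
        Σhead P v + Σtail P u + 2 * count P     ≡⟨ shuffle (Σhead P v) (Σtail P u) (count P) ⟩
        (Σtail P u + count P) + (Σhead P v + count P)
          ≡⟨ cong₂ _+_ (Σhead-away u P (trans (cong (_+ k) (d-refl u)) (sym tight))) (Σtail-towards P tight) ⟨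
        Σhead P u + Σtail P v                   ≤⟨ potential-walk P U ⟩
        Σhead P v + Σtail P u + 2 * count U     ∎))
      where
      open ℕ.≤-Reasoning
      shuffle : ∀ x y z → (x + y) + 2 * z ≡ (y + z) + (x + z)
      shuffle = solve-∀

    avoiding-walk : ∀ {u v} → ConnAvoiding G F u v → Σ ℕ λ k → Σ (Walk G u v k) λ U → count U ≡ 0
    avoiding-walk here = 0 , nil , refl
    avoiding-walk (step e Fe o rest) with avoiding-walk rest
    ... | k , U , count≡0 = suc k , cons (e , o) U , trans (cong (λ b → bit b + count U) Fe) count≡0

    module Quotient {H : Graph} {π : Vertex G → Vertex H} (isQ : IsQuotient G F H π) where
      open IsQuotient isQ

      ends-separate : ∀ e → F e ≡ true → π (fst G e) ≢ π (snd G e)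
      ends-separate e Fe merged with avoiding-walk (Equivalence.to (components (fst G e) (snd G e)) merged)
      ... | _ , U , count≡0 = 1≰0 (subst₂ _≤_ count-e count≡0 (geodesic-count-minimal e-walk d≡1 U))
        where
        e-walk : Walk G (fst G e) (snd G e) 1
        e-walk = cons (e , inj₁ refl) nil
        d≡1 : d (fst G e) (snd G e) ≡ 1
        d≡1 = ℕ.≤-antisym (d≤length e-walk) (ℕ.n≢0⇒n>0 (λ d≡0 → <-irrefl (d≡0⇒≡ d≡0) (ordered G e)))
        count-e : count e-walk ≡ 1
        count-e rewrite Fe = refl
        1≰0 : ¬ (1 ≤ 0)
        1≰0 ()

      lift : ∀ {X Y k} → Walk H X Y k → ∀ {u v} → π u ≡ X → π v ≡ Y →
             Σ ℕ λ l → Σ (Walk G u v l) λ U → count U ≤ k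
      lift nil πu πv with avoiding-walk (Equivalence.to (components _ _) (trans πu (sym πv)))
      ... | l , U , count≡0 = l , U , ℕ.≤-reflexive count≡0
      lift (cons {w = Z} a V) πu πv with Equivalence.to (adjacency _ Z) a
      ... | _ , u′ , v′ , a′ , πu′ , πv′
          with avoiding-walk (Equivalence.to (components _ _) (trans πu (sym πu′))) | lift V πv′ πv
      ...   | l₁ , U₁ , count≡0 | l₂ , U₂ , count≤ = _ , (U₁ ++ʷ cons a′ U₂) , (begin
        count (U₁ ++ʷ cons a′ U₂)                 ≡⟨ count-++ U₁ (cons a′ U₂) ⟩
        count U₁ + (bit (F (edge a′)) + count U₂) ≡⟨ cong (_+ _) count≡0 ⟩
        bit (F (edge a′)) + count U₂              ≤⟨ ℕ.+-mono-≤ (bit≤1 (F (edge a′))) count≤ ⟩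
        suc _                                     ∎)
        where
        open ℕ.≤-Reasoning
        bit≤1 : ∀ b → bit b ≤ 1
        bit≤1 true  = ℕ.≤-refl
        bit≤1 false = z≤n

      project : ∀ {u v l} (U : Walk G u v l) → Σ ℕ λ k → Walk H (π u) (π v) k × k ≤ count U
      project nil = 0 , nil , z≤n
      project {u} {v} (cons {w = w} a U) with project U | F (edge a) in Fa
      ... | k , V , k≤ | false =
        k , subst (λ X → Walk H X (π v) k) (sym (quotient-merges isQ a Fa)) V , k≤
      ... | k , V , k≤ | true with π u ≟ π w
      ...   | yes πu≡πw = k , subst (λ X → Walk H X (π v) k) (sym πu≡πw) V , ℕ.m≤n⇒m≤1+n k≤
      ...   | no πu≢πw  =
        suc k , cons (Equivalence.from (adjacency (π u) (π w)) (πu≢πw , u , w , a , refl , refl)) V , s≤s k≤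

      quotient-distance : ∀ {dH} → IsDistance H dH → ∀ u v → dH (π u) (π v) ≡ count (geodesic u v)
      quotient-distance isDH u v with project (geodesic u v) | lift (proj₁ (isDH (π u) (π v))) refl refl
      ... | k , V , k≤ | l , U , count≤ = ℕ.≤-antisym
        (ℕ.≤-trans (proj₂ (isDH _ _) k V) k≤)
        (ℕ.≤-trans (geodesic-count-minimal (geodesic u v) refl U) count≤)

  module CutMethod {G : Graph} {d : Vertex G → Vertex G → ℕ} (isD : IsDistance G d)
                   {r : ℕ} {part : Edge G → Fin r} (cp : IsCPartition G d r part)
                   {Q : Fin r → Graph} {π : (i : Fin r) → Vertex G → Vertex (Q i)}
                   (isQ : ∀ i → IsQuotient G (inPart G part i) (Q i) (π i))
                   {dQ : (i : Fin r) → Vertex (Q i) → Vertex (Q i) → ℕ}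
                   (isDQ : ∀ i → IsDistance (Q i) (dQ i)) where
    open Distance isD
    module Cut i = ΘClosedCut isD (inPart G part i) (inPart-isΘClosed {G} {d} cp i)
    module Cut/ i = Cut.Quotient i (isQ i)

    d/ : Fin r → Vertex G → Vertex G → ℕ
    d/ i x y = dQ i (π i x) (π i y)

    Σcount≡length : ∀ {u v k} (U : Walk G u v k) → Σℕ (λ i → Cut.count i U) ≡ k
    Σcount≡length nil        = Σℕ-zero r
    Σcount≡length (cons a U) = trans (Σℕ-distrib-+ (indicator (part (proj₁ a))) (λ i → Cut.count i U))
                                     (cong₂ _+_ (Σℕ-indicator (part (proj₁ a))) (Σcount≡length U))

    distance-decomposition : ∀ u v → d u v ≡ Σℕ (λ i → d/ i u v)
    distance-decomposition u v =
      sym (trans (Σℕ-cong (λ i → Cut/.quotient-distance i (isDQ i) u v)) (Σcount≡length (geodesic u v)))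

    end-merge : ∀ j e → j ≢ part e → ∀ b b′ → π j (end G e b) ≡ π j (end G e b′)
    end-merge j e j≢ b b′ = trans (end≡fst b) (sym (end≡fst b′))
      where
      end≡fst : ∀ b → π j (end G e b) ≡ π j (fst G e)
      end≡fst false = refl
      end≡fst true  = sym (quotient-merges (isQ j) (e , inj₁ refl) (⌊⌋-false (part e ≟ j) (≢-sym j≢)))

    edge-distance-decomposition : ∀ e f → distEE G d e f ≡ Σℕ (λ i → distEE G (d/ i) e f)
    edge-distance-decomposition e f = begin
      min₄ (λ b c → d (end G e b) (end G f c))
        ≡⟨ min₄-cong (λ b c → distance-decomposition (end G e b) (end G f c)) ⟩
      min₄ (λ b c → Σℕ (λ i → d/ i (end G e b) (end G f c)))
        ≡⟨ min₄-Σℕ (λ i b c → d/ i (end G e b) (end G f c)) (part e) (part f)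
             (λ j j≢ b b′ c → cong (λ x → dQ j x (π j (end G f c))) (end-merge j e j≢ b b′))
             (λ j j≢ b c c′ → cong (dQ j (π j (end G e b))) (end-merge j f j≢ c c′)) ⟩
      Σℕ (λ i → min₄ (λ b c → d/ i (end G e b) (end G f c))) ∎
      where open ≡-Reasoning

open GraphDistances

module WeightedSums {c ℓ} (R : CommutativeSemiring c ℓ) where
  open import Data.Nat using (zero; suc)
  open import Data.Fin using (zero; suc)
  open CommutativeSemiring R
    hiding (zero) renaming (refl to ≈-refl; sym to ≈-sym; trans to ≈-trans; reflexive to ≈-reflexive)
  open Weighted R
  open import Algebra.Properties.Semiring.Sum semiring
    using (sum-cong-≋; sum-remove; ∑-comm; ∑-distrib-+; sum-replicate-zero; *-distribˡ-sum; *-distribʳ-sum)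
  open import Algebra.Properties.Semiring.Mult semiring
    using (×-assoc-*; ×-congʳ; ×-homo-+) renaming (_×_ to _·_)
  open import Relation.Binary.Reasoning.Setoid setoid

  guard : Bool → Carrier → Carrier
  guard b x = if b then x else 0#

  guard-cong : ∀ b {x y} → x ≈ y → guard b x ≈ guard b y
  guard-cong true  x≈y = x≈y
  guard-cong false _   = ≈-refl

  guard-comm : ∀ p q x → guard p (guard q x) ≡ guard q (guard p x)
  guard-comm true  true  x = refl
  guard-comm true  false x = refl
  guard-comm false true  x = refl
  guard-comm false false x = refl

  guard-partition : ∀ p q x →
    guard (not p) (guard (not q) x) + guard p (guard q x) + (guard (not p) (guard q x) + guard p (guard (not q) x)) ≈ x
  guard-partition true  true  x = ≈-trans (+-cong (+-identityˡ x) (+-identityˡ 0#)) (+-identityʳ x)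
  guard-partition true  false x = ≈-trans (+-cong (+-identityˡ 0#) (+-identityˡ x)) (+-identityˡ x)
  guard-partition false true  x = ≈-trans (+-cong (+-identityˡ 0#) (+-identityʳ x)) (+-identityˡ x)
  guard-partition false false x = ≈-trans (+-cong (+-identityʳ x) (+-identityˡ 0#)) (+-identityʳ x)

  ∑-guard : ∀ {k} b (f : Fin k → Carrier) → ∑ (λ i → guard b (f i)) ≈ guard b (∑ f)
  ∑-guard     true  f = ≈-refl
  ∑-guard {k} false f = sum-replicate-zero k

  ∑-guard-none : ∀ {k} (b : Fin k → Bool) → (∀ a → b a ≡ false) →
                 ∀ x → ∑ (λ a → guard (b a) x) ≈ 0#
  ∑-guard-none {k} b none x =
    ≈-trans (sum-cong-≋ (λ a → ≈-reflexive (cong (λ t → guard t x) (none a)))) (sum-replicate-zero k)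

  ∑-guard-unique : ∀ {k} (b : Fin k → Bool) a₀ → b a₀ ≡ true → (∀ a → b a ≡ true → a ≡ a₀) →
                   ∀ x → ∑ (λ a → guard (b a) x) ≈ x
  ∑-guard-unique {suc k} b a₀ ba₀ unique x = begin
    ∑ (λ a → guard (b a) x)                            ≈⟨ sum-remove {i = a₀} (λ a → guard (b a) x) ⟩
    guard (b a₀) x + ∑ (λ l → guard (b (punchIn a₀ l)) x)
      ≈⟨ +-cong (≈-reflexive (cong (λ t → guard t x) ba₀)) (∑-guard-none (b ∘ punchIn a₀) elsewhere x) ⟩
    x + 0#                                             ≈⟨ +-identityʳ x ⟩
    x                                                  ∎
    where
    elsewhere : ∀ l → b (punchIn a₀ l) ≡ false
    elsewhere l with b (punchIn a₀ l) in bl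
    ... | true  = ⊥-elim (punchInᵢ≢i a₀ l (unique _ bl))
    ... | false = refl

  ×≈* : ∀ n y → n · y ≈ (n · 1#) * y
  ×≈* n y = ≈-sym (≈-trans (×-assoc-* n 1# y) (×-congʳ n (*-identityˡ y)))

  ×-zeroʳ : ∀ n → n · 0# ≈ 0#
  ×-zeroʳ n = ≈-trans (×≈* n 0#) (zeroʳ _)

  ×-distrib-∑ : ∀ {k} n (f : Fin k → Carrier) → n · ∑ f ≈ ∑ (λ i → n · f i)
  ×-distrib-∑ n f =
    ≈-trans (×≈* n (∑ f)) (≈-trans (*-distribˡ-sum (n · 1#) f) (sum-cong-≋ (λ i → ≈-sym (×≈* n (f i)))))

  ∑-×-Σℕ : ∀ {k} (n : Fin k → ℕ) x → ∑ (λ i → n i · x) ≈ Σℕ n · x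
  ∑-×-Σℕ {zero}  n x = ≈-refl
  ∑-×-Σℕ {suc k} n x = ≈-trans (+-congˡ (∑-×-Σℕ (n ∘ suc) x)) (≈-sym (×-homo-+ x (n zero) (Σℕ (n ∘ suc))))

  ∑-*-∑ : ∀ {k l} (f : Fin k → Carrier) (g : Fin l → Carrier) →
          ∑ f * ∑ g ≈ ∑ (λ a → ∑ (λ b → f a * g b))
  ∑-*-∑ f g = ≈-trans (*-distribʳ-sum (∑ g) f) (sum-cong-≋ (λ a → *-distribˡ-sum (f a) g))

  ∑∑-comm : ∀ {k l m n} (F : Fin k → Fin l → Fin m → Fin n → Carrier) →
            ∑ (λ a → ∑ λ b → ∑ λ e → ∑ λ f → F a b e f)
            ≈ ∑ (λ e → ∑ λ f → ∑ λ a → ∑ λ b → F a b e f)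
  ∑∑-comm F = begin
    ∑ (λ a → ∑ λ b → ∑ λ e → ∑ λ f → F a b e f)
      ≈⟨ sum-cong-≋ (λ a → ∑-comm (λ b e → ∑ λ f → F a b e f)) ⟩
    ∑ (λ a → ∑ λ e → ∑ λ b → ∑ λ f → F a b e f)
      ≈⟨ sum-cong-≋ (λ a → sum-cong-≋ (λ e → ∑-comm (λ b f → F a b e f))) ⟩
    ∑ (λ a → ∑ λ e → ∑ λ f → ∑ λ b → F a b e f)
      ≈⟨ ∑-comm (λ a e → ∑ λ f → ∑ λ b → F a b e f) ⟩
    ∑ (λ e → ∑ λ a → ∑ λ f → ∑ λ b → F a b e f)
      ≈⟨ sum-cong-≋ (λ e → ∑-comm (λ a f → ∑ λ b → F a b e f)) ⟩
    ∑ (λ e → ∑ λ f → ∑ λ a → ∑ λ b → F a b e f) ∎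

  ∑∑-+ : ∀ {k l} (F₁ F₂ : Fin k → Fin l → Carrier) →
         ∑ (λ e → ∑ λ f → F₁ e f) + ∑ (λ e → ∑ λ f → F₂ e f)
         ≈ ∑ (λ e → ∑ λ f → F₁ e f + F₂ e f)
  ∑∑-+ F₁ F₂ = ≈-trans (≈-sym (∑-distrib-+ (λ e → ∑ λ f → F₁ e f) (λ e → ∑ λ f → F₂ e f)))
                       (sum-cong-≋ (λ e → ≈-sym (∑-distrib-+ (F₁ e) (F₂ e))))

  ×-guard-* : ∀ p q (K δ : ℕ) x y → (p ≡ true → q ≡ true → K ≡ δ) →
              K · (guard p x * guard q y) ≈ guard p (guard q (δ · (x * y)))
  ×-guard-* true  true  K δ x y K≡δ rewrite K≡δ refl refl = ≈-refl
  ×-guard-* true  false K δ x y _ = ≈-trans (×-congʳ K (zeroʳ x)) (×-zeroʳ K)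
  ×-guard-* false q     K δ x y _ = ≈-trans (×-congʳ K (zeroˡ _)) (×-zeroʳ K)

  ∑∑-pushforward : ∀ {nA nB m} (α : Fin m → Fin nA → Bool) (β : Fin m → Fin nB → Bool)
                   (Pα Pβ : Fin m → Bool) (K : Fin nA → Fin nB → ℕ) (δ : Fin m → Fin m → ℕ)
                   (w : Fin m → Carrier) →
                   (∀ e x → ∑ (λ a → guard (α e a) x) ≈ guard (Pα e) x) →
                   (∀ f x → ∑ (λ b → guard (β f b) x) ≈ guard (Pβ f) x) →
                   (∀ e f a b → α e a ≡ true → β f b ≡ true → K a b ≡ δ e f) →
                   ∑ (λ a → ∑ λ b → K a b · (∑ (λ e → guard (α e a) (w e)) * ∑ (λ f → guard (β f b) (w f))))
                   ≈ ∑ (λ e → ∑ λ f → guard (Pα e) (guard (Pβ f) (δ e f · (w e * w f))))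
  ∑∑-pushforward α β Pα Pβ K δ w ∑α ∑β K≡δ = begin
    ∑ (λ a → ∑ λ b → K a b · (∑ (λ e → guard (α e a) (w e)) * ∑ (λ f → guard (β f b) (w f))))
      ≈⟨ sum-cong-≋ (λ a → sum-cong-≋ (λ b → expand a b)) ⟩
    ∑ (λ a → ∑ λ b → ∑ λ e → ∑ λ f → K a b · (guard (α e a) (w e) * guard (β f b) (w f)))
      ≈⟨ sum-cong-≋ (λ a → sum-cong-≋ (λ b → sum-cong-≋ (λ e → sum-cong-≋ (λ f →
           ×-guard-* (α e a) (β f b) (K a b) (δ e f) (w e) (w f) (K≡δ e f a b))))) ⟩
    ∑ (λ a → ∑ λ b → ∑ λ e → ∑ λ f → guard (α e a) (guard (β f b) (term e f)))
      ≈⟨ ∑∑-comm (λ a b e f → guard (α e a) (guard (β f b) (term e f))) ⟩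
    ∑ (λ e → ∑ λ f → ∑ λ a → ∑ λ b → guard (α e a) (guard (β f b) (term e f)))
      ≈⟨ sum-cong-≋ (λ e → sum-cong-≋ (λ f → sum-cong-≋ (λ a →
           ≈-trans (∑-guard (α e a) (λ b → guard (β f b) (term e f)))
                   (guard-cong (α e a) (∑β f (term e f)))))) ⟩
    ∑ (λ e → ∑ λ f → ∑ λ a → guard (α e a) (guard (Pβ f) (term e f)))
      ≈⟨ sum-cong-≋ (λ e → sum-cong-≋ (λ f → ∑α e (guard (Pβ f) (term e f)))) ⟩
    ∑ (λ e → ∑ λ f → guard (Pα e) (guard (Pβ f) (term e f))) ∎
    where
    term : Fin _ → Fin _ → Carrier
    term e f = δ e f · (w e * w f)
    expand : ∀ a b → K a b · (∑ (λ e → guard (α e a) (w e)) * ∑ (λ f → guard (β f b) (w f)))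
                     ≈ ∑ (λ e → ∑ λ f → K a b · (guard (α e a) (w e) * guard (β f b) (w f)))
    expand a b = ≈-trans (×-congʳ (K a b) (∑-*-∑ (λ e → guard (α e a) (w e)) (λ f → guard (β f b) (w f))))
                (≈-trans (×-distrib-∑ (K a b) (λ e → ∑ λ f → guard (α e a) (w e) * guard (β f b) (w f)))
                  (sum-cong-≋ (λ e → ×-distrib-∑ (K a b) (λ f → guard (α e a) (w e) * guard (β f b) (w f)))))

  ∑∑-·-Σℕ : ∀ {m r} (δ : Fin m → Fin m → ℕ) (δᵢ : Fin r → Fin m → Fin m → ℕ) (w : Fin m → Carrier) →
            (∀ e f → δ e f ≡ Σℕ (λ i → δᵢ i e f)) →
            ∑ (λ e → ∑ λ f → δ e f · (w e * w f))
            ≈ ∑ (λ i → ∑ λ e → ∑ λ f → δᵢ i e f · (w e * w f))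
  ∑∑-·-Σℕ δ δᵢ w δ≡Σ = ≈-sym (≈-trans (∑-comm (λ i e → ∑ λ f → δᵢ i e f · (w e * w f)))
    (sum-cong-≋ λ e → ≈-trans (∑-comm (λ i f → δᵢ i e f · (w e * w f)))
      (sum-cong-≋ λ f → ≈-trans (∑-×-Σℕ (λ i → δᵢ i e f) (w e * w f))
                                (≈-reflexive (cong (_· (w e * w f)) (sym (δ≡Σ e f)))))))

  module QuotientIndices (half : Carrier) (half+half : half + half ≈ 1#)
         {G : Graph} {F : Edge G → Bool} {H : Graph} {π : Vertex G → Vertex H} (isQ : IsQuotient G F H π)
         (separate : ∀ e → F e ≡ true → π (fst G e) ≢ π (snd G e))
         {dH : Vertex H → Vertex H → ℕ} (dH-sym : ∀ X Y → dH X Y ≡ dH Y X)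
         (we : Edge G → Carrier) where

    d/ : Vertex G → Vertex G → ℕ
    d/ x y = dH (π x) (π y)

    term : Edge G → Edge G → Carrier
    term e f = distEE G d/ e f · (we e * we f)

    wq : Vertex H → Carrier
    wq = wQ G we F H π

    weq : Edge H → Carrier
    weq = weQ G we H π

    -- wq X and weq h are definitionally ∑ (λ e → guard (onVertex e X) (we e))
    -- and ∑ (λ e → guard (onEdge e h) (we e)).
    onVertex : Edge G → Vertex H → Bool
    onVertex e X = not (F e) ∧ ⌊ π (fst G e) ≟ X ⌋ ∧ ⌊ π (snd G e) ≟ X ⌋

    along against : Edge G → Edge H → Bool
    along   e h = ⌊ π (fst G e) ≟ fst H h ⌋ ∧ ⌊ π (snd G e) ≟ snd H h ⌋
    against e h = ⌊ π (fst G e) ≟ snd H h ⌋ ∧ ⌊ π (snd G e) ≟ fst H h ⌋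

    onEdge : Edge G → Edge H → Bool
    onEdge e h = along e h ∨ against e h

    onVertex-true : ∀ e X → onVertex e X ≡ true → π (fst G e) ≡ X × π (snd G e) ≡ X
    onVertex-true e X on with ∧-true⁻¹ (not (F e)) on
    ... | _ , on′ with ∧-true⁻¹ ⌊ π (fst G e) ≟ X ⌋ on′
    ...   | p , q = ⌊⌋-true⁻¹ (π (fst G e) ≟ X) p , ⌊⌋-true⁻¹ (π (snd G e) ≟ X) q

    onEdge-true : ∀ e h → onEdge e h ≡ true → SameEnds (π (fst G e) , π (snd G e)) (ends H h)
    onEdge-true e h on with ∨-true⁻¹ (along e h) on
    ... | inj₁ on′ with ∧-true⁻¹ ⌊ π (fst G e) ≟ fst H h ⌋ on′
    ...   | p , q = inj₁ (⌊⌋-true⁻¹ (π (fst G e) ≟ fst H h) p , ⌊⌋-true⁻¹ (π (snd G e) ≟ snd H h) q)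
    onEdge-true e h on | inj₂ on′ with ∧-true⁻¹ ⌊ π (fst G e) ≟ snd H h ⌋ on′
    ...   | p , q = inj₂ (⌊⌋-true⁻¹ (π (fst G e) ≟ snd H h) p , ⌊⌋-true⁻¹ (π (snd G e) ≟ fst H h) q)

    onEdge-intro : ∀ e h → SameEnds (π (fst G e) , π (snd G e)) (ends H h) → onEdge e h ≡ true
    onEdge-intro e h (inj₁ (p , q)) =
      cong (_∨ against e h) (∧-true (⌊⌋-true (π (fst G e) ≟ fst H h) p) (⌊⌋-true (π (snd G e) ≟ snd H h) q))
    onEdge-intro e h (inj₂ (p , q)) = trans
      (cong (along e h ∨_) (∧-true (⌊⌋-true (π (fst G e) ≟ snd H h) p) (⌊⌋-true (π (snd G e) ≟ fst H h) q)))
      (∨-zeroʳ (along e h))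

    ∑-onVertex : ∀ e x → ∑ (λ X → guard (onVertex e X) x) ≈ guard (not (F e)) x
    ∑-onVertex e x = by-cases (F e) refl
      where
      by-cases : ∀ b → F e ≡ b → ∑ (λ X → guard (onVertex e X) x) ≈ guard (not b) x
      by-cases true  Fe = ∑-guard-none (onVertex e) (λ X → cong (λ t → not t ∧ _) Fe) x
      by-cases false Fe =
        ∑-guard-unique (onVertex e) (π (fst G e)) on-π₁ (λ X on → sym (proj₁ (onVertex-true e X on))) x
        where
        on-π₁ : onVertex e (π (fst G e)) ≡ true
        on-π₁ = trans (cong (λ t → not t ∧ _) Fe)
                      (∧-true (⌊⌋-true (π (fst G e) ≟ π (fst G e)) refl)
                              (⌊⌋-true (π (snd G e) ≟ π (fst G e)) (sym (quotient-merges isQ (e , inj₁ refl) Fe))))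

    ∑-onEdge : ∀ e x → ∑ (λ h → guard (onEdge e h) x) ≈ guard (F e) x
    ∑-onEdge e x = by-cases (F e) refl
      where
      by-cases : ∀ b → F e ≡ b → ∑ (λ h → guard (onEdge e h) x) ≈ guard b x
      by-cases false Fe = ∑-guard-none (onEdge e) (λ h → ¬-not (λ on → SameEnds-loop H h (loop h on))) x
        where
        loop : ∀ h → onEdge e h ≡ true → SameEnds (π (fst G e) , π (fst G e)) (ends H h)
        loop h on = subst (λ y → SameEnds (π (fst G e) , y) (ends H h))
                          (sym (quotient-merges isQ (e , inj₁ refl) Fe)) (onEdge-true e h on)
      by-cases true Fe with Equivalence.from (IsQuotient.adjacency isQ (π (fst G e)) (π (snd G e)))
                              (separate e Fe , fst G e , snd G e , (e , inj₁ refl) , refl , refl)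
      ... | h₀ , o = ∑-guard-unique (onEdge e) h₀ (onEdge-intro e h₀ ends-h₀)
                       (λ h on → SameEnds-injective H h h₀ (onEdge-true e h on) ends-h₀) x
        where
        ends-h₀ : SameEnds (π (fst G e) , π (snd G e)) (ends H h₀)
        ends-h₀ = SameEnds-sym (adj-ends {H} {e = h₀} o)

    dist-vertices : ∀ e f X Y → onVertex e X ≡ true → onVertex f Y ≡ true → dH X Y ≡ distEE G d/ e f
    dist-vertices e f X Y on on′ = sym (trans
      (min₄-SameEnds dH (π ∘ end G e) (π ∘ end G f) (λ _ → X) (λ _ → Y)
                     (inj₁ (onVertex-true e X on)) (inj₁ (onVertex-true f Y on′)))
      (min₄-const (dH X Y)))

    dist-vertex-edge : ∀ e f X h → onVertex e X ≡ true → onEdge f h ≡ true → distVE H dH X h ≡ distEE G d/ e f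
    dist-vertex-edge e f X h on on′ = sym (trans
      (min₄-SameEnds dH (π ∘ end G e) (π ∘ end G f) (λ _ → X) (end H h)
                     (inj₁ (onVertex-true e X on)) (onEdge-true f h on′))
      (min₄-constˡ (λ c → dH X (end H h c))))

    dist-edges : ∀ e f h h′ → onEdge e h ≡ true → onEdge f h′ ≡ true → distEE H dH h h′ ≡ distEE G d/ e f
    dist-edges e f h h′ on on′ = sym (min₄-SameEnds dH (π ∘ end G e) (π ∘ end G f) (end H h) (end H h′)
                                                    (onEdge-true e h on) (onEdge-true f h′ on′))

    block : (Edge G → Bool) → (Edge G → Bool) → Carrier
    block P P′ = ∑ (λ e → ∑ λ f → guard (P e) (guard (P′ f) (term e f)))

    term-sym : ∀ e f → term f e ≈ term e f
    term-sym e f =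
      ≈-trans (≈-reflexive (cong (_· (we f * we e)) (distEE-sym G (λ x y → dH-sym (π x) (π y)) f e)))
              (×-congʳ (distEE G d/ e f) (*-comm (we f) (we e)))

    block-swap : ∀ P P′ → block P P′ ≈ block P′ P
    block-swap P P′ = ≈-trans (∑-comm (λ e f → guard (P e) (guard (P′ f) (term e f))))
      (sum-cong-≋ λ e → sum-cong-≋ λ f →
        ≈-trans (≈-reflexive (guard-comm (P f) (P′ e) (term f e)))
                (guard-cong (P′ e) (guard-cong (P f) (term-sym e f))))

    blocks-total : block (not ∘ F) (not ∘ F) + block F F + (block (not ∘ F) F + block F (not ∘ F))
                   ≈ ∑ (λ e → ∑ λ f → term e f)
    blocks-total = begin
      block (not ∘ F) (not ∘ F) + block F F + (block (not ∘ F) F + block F (not ∘ F))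
        ≈⟨ +-cong (∑∑-+ (part not not) (part id id)) (∑∑-+ (part not id) (part id not)) ⟩
      ∑ (λ e → ∑ λ f → part not not e f + part id id e f)
        + ∑ (λ e → ∑ λ f → part not id e f + part id not e f)
        ≈⟨ ∑∑-+ (λ e f → part not not e f + part id id e f) (λ e f → part not id e f + part id not e f) ⟩
      ∑ (λ e → ∑ λ f → part not not e f + part id id e f + (part not id e f + part id not e f))
        ≈⟨ sum-cong-≋ (λ e → sum-cong-≋ λ f → guard-partition (F e) (F f) (term e f)) ⟩
      ∑ (λ e → ∑ λ f → term e f) ∎
      where
      part : (Bool → Bool) → (Bool → Bool) → Edge G → Edge G → Carrier
      part s t e f = guard (s (F e)) (guard (t (F f)) (term e f))

    quotient-indices : W half H dH wq + We half H dH weq + Wve H dH wq weq ≈ half * ∑ (λ e → ∑ λ f → term e f)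
    quotient-indices = begin
      W half H dH wq + We half H dH weq + Wve H dH wq weq
        ≈⟨ +-cong (+-cong (*-congˡ W-block) (*-congˡ We-block)) Wve-block ⟩
      half * B₀₀ + half * B₁₁ + B₀₁
        ≈⟨ +-congˡ (≈-trans (≈-sym (*-identityˡ B₀₁)) (*-congʳ (≈-sym half+half))) ⟩
      half * B₀₀ + half * B₁₁ + (half + half) * B₀₁
        ≈⟨ +-cong (≈-sym (distribˡ half B₀₀ B₁₁))
                  (≈-trans (distribʳ B₀₁ half half) (+-congˡ (*-congˡ (block-swap (not ∘ F) F)))) ⟩
      half * (B₀₀ + B₁₁) + (half * B₀₁ + half * B₁₀)
        ≈⟨ +-congˡ (≈-sym (distribˡ half B₀₁ B₁₀)) ⟩
      half * (B₀₀ + B₁₁) + half * (B₀₁ + B₁₀)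
        ≈⟨ ≈-sym (distribˡ half (B₀₀ + B₁₁) (B₀₁ + B₁₀)) ⟩
      half * (B₀₀ + B₁₁ + (B₀₁ + B₁₀))
        ≈⟨ *-congˡ blocks-total ⟩
      half * ∑ (λ e → ∑ λ f → term e f) ∎
      where
      B₀₀ = block (not ∘ F) (not ∘ F)
      B₁₁ = block F F
      B₀₁ = block (not ∘ F) F
      B₁₀ = block F (not ∘ F)
      W-block : ∑ (λ X → ∑ λ Y → dH X Y · (wq X * wq Y)) ≈ B₀₀
      W-block = ∑∑-pushforward onVertex onVertex (not ∘ F) (not ∘ F) dH (distEE G d/) we
                               ∑-onVertex ∑-onVertex dist-vertices
      We-block : ∑ (λ h → ∑ λ h′ → distEE H dH h h′ · (weq h * weq h′)) ≈ B₁₁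
      We-block = ∑∑-pushforward onEdge onEdge F F (distEE H dH) (distEE G d/) we
                                ∑-onEdge ∑-onEdge dist-edges
      Wve-block : Wve H dH wq weq ≈ B₀₁
      Wve-block = ∑∑-pushforward onVertex onEdge (not ∘ F) F (distVE H dH) (distEE G d/) we
                                 ∑-onVertex ∑-onEdge dist-vertex-edge

open WeightedSums

theorem3p3 : ∀ {c ℓ} (R : CommutativeSemiring c ℓ) →
    let open CommutativeSemiring R
        open Weighted R
    in (half : Carrier) → half + half ≈ 1# →
       (G : Graph) → Connected G →
       (d : Vertex G → Vertex G → ℕ) → IsDistance G d →
       (we : Edge G → Carrier) →
       (r : ℕ) (part : Edge G → Fin r) → IsCPartition G d r part →
       (Q : Fin r → Graph) (π : (i : Fin r) → Vertex G → Vertex (Q i)) →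
       (∀ i → IsQuotient G (inPart G part i) (Q i) (π i)) →
       (dQ : (i : Fin r) → Vertex (Q i) → Vertex (Q i) → ℕ) →
       (∀ i → IsDistance (Q i) (dQ i)) →
       We half G d we ≈
         ∑ (λ i → W half (Q i) (dQ i) (wQ G we (inPart G part i) (Q i) (π i))
                 + We half (Q i) (dQ i) (weQ G we (Q i) (π i))
                 + Wve (Q i) (dQ i) (wQ G we (inPart G part i) (Q i) (π i))
                       (weQ G we (Q i) (π i)))
theorem3p3 R half half+half G _ d isD we r part cp Q π isQ dQ isDQ = begin
  half * ∑ (λ e → ∑ λ f → distEE G d e f · (we e * we f))
    ≈⟨ *-congˡ (∑∑-·-Σℕ R (distEE G d) (λ i → distEE G (d/ i)) we edge-distance-decomposition) ⟩
  half * ∑ (λ i → ∑ λ e → ∑ λ f → distEE G (d/ i) e f · (we e * we f))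
    ≈⟨ *-distribˡ-sum half (λ i → ∑ λ e → ∑ λ f → distEE G (d/ i) e f · (we e * we f)) ⟩
  ∑ (λ i → half * ∑ λ e → ∑ λ f → distEE G (d/ i) e f · (we e * we f))
    ≈⟨ sum-cong-≋ (λ i → ≈-sym (Quotientᵢ.quotient-indices i)) ⟩
  ∑ (λ i → W half (Q i) (dQ i) (wQ G we (inPart G part i) (Q i) (π i))
          + We half (Q i) (dQ i) (weQ G we (Q i) (π i))
          + Wve (Q i) (dQ i) (wQ G we (inPart G part i) (Q i) (π i)) (weQ G we (Q i) (π i))) ∎
  where
  open CommutativeSemiring R using (_+_; _*_; *-congˡ) renaming (sym to ≈-sym)
  open Weighted R
  open SetoidReasoning (CommutativeSemiring.setoid R)
  open SemiringSum (CommutativeSemiring.semiring R) using (sum-cong-≋; *-distribˡ-sum)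
  open SemiringMult (CommutativeSemiring.semiring R) using () renaming (_×_ to _·_)
  open CutMethod isD cp isQ isDQ
  module Quotientᵢ i = QuotientIndices R half half+half (isQ i) (Cut/.ends-separate i) (Distance.d-sym (isDQ i)) we
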